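{- Let $R$ be a commutative ring with identity. For $i=1,2$ let $G_i$ be an abelian group, let $T_i:\tau R[[\tau]]\to G_i$ be an injective map with $T_i(0)$ equal to the identity of $G_i$, and let $F_i\in R[[X,Y]]$ have zero constant term and satisfy $T_i(g)+T_i(h)=T_i(F_i(g,h))$ (addition in $G_i$) for all $g,h\in\tau R[[\tau]]$. Suppose $\psi:G_1\to G_2$ is a group homomorphism and $U\in R[[\tau]]$ has zero constant term and satisfies $\psi(T_1(g))=T_2(U(g))$ for all $g\in\tau R[[\tau]]$. Then $U$ is a homomorphism of formal group laws from $F_1$ to $F_2$, i.e. $U(F_1(X,Y))=F_2(U(X),U(Y))$.
   Context: A formal group law over $R$ is a power series $F\in R[[X,Y]]$ with $F(X,0)=X$, $F(X,Y)=F(Y,X)$, $F(F(X,Y),Z)=F(X,F(Y,Z))$ (under the hypotheses above, each $F_i$ is one). A homomorphism from a formal group law $F$ to a formal group law $F'$ is a power series $U\in\tau R[[\tau]]$ (zero constant term) with $U(F(X,Y))=F'(U(X),U(Y))$. -}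

module Defs where

open import Level using (_⊔_)
open import Data.Nat using (ℕ; zero; suc; _∸_) renaming (_+_ to _+ℕ_)
open import Algebra.Bundles using (CommutativeRing; AbelianGroup)
open import Algebra.Morphism.Structures using (module GroupMorphisms)

module PowerSeries {c ℓ} (R : CommutativeRing c ℓ) where
  open CommutativeRing R

  ∑< : ℕ → (ℕ → Carrier) → Carrier
  ∑< zero    f = 0#
  ∑< (suc n) f = ∑< n f + f n

  PS : Set c
  PS = ℕ → Carrier

  -- two-variable series R[[X,Y]]: coefficient of X^i Y^j
  PS2 : Set c
  PS2 = ℕ → ℕ → Carrier

  _≈₁_ : PS → PS → Set ℓ
  f ≈₁ g = ∀ n → f n ≈ g n

  _≈₂_ : PS2 → PS2 → Set ℓ
  A ≈₂ B = ∀ m n → A m n ≈ B m n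

  ZeroConst : PS → Set ℓ
  ZeroConst f = f 0 ≈ 0#

  ZeroConst2 : PS2 → Set ℓ
  ZeroConst2 F = F 0 0 ≈ 0#

  zero₁ : PS
  zero₁ _ = 0#

  one₁ : PS
  one₁ zero    = 1#
  one₁ (suc _) = 0#

  _·₁_ : PS → PS → PS
  (f ·₁ g) n = ∑< (suc n) (λ k → f k * g (n ∸ k))

  pow₁ : PS → ℕ → PS
  pow₁ f zero    = one₁
  pow₁ f (suc k) = f ·₁ pow₁ f k

  one₂ : PS2
  one₂ zero    zero    = 1#
  one₂ zero    (suc _) = 0#
  one₂ (suc _) _       = 0#

  _·₂_ : PS2 → PS2 → PS2
  (A ·₂ B) m n = ∑< (suc m) (λ i → ∑< (suc n) (λ j → A i j * B (m ∸ i) (n ∸ j)))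

  pow₂ : PS2 → ℕ → PS2
  pow₂ A zero    = one₂
  pow₂ A (suc k) = A ·₂ pow₂ A k

  inX : PS → PS2
  inX U m zero    = U m
  inX U m (suc _) = 0#

  inY : PS → PS2
  inY U zero    n = U n
  inY U (suc _) n = 0#

  -- U(g) for g with zero constant term: coeff n = Σ_{k ≤ n} U_k (g^k)_n
  -- (terms with k > n vanish since g has zero constant term)
  comp₁ : PS → PS → PS
  comp₁ U g n = ∑< (suc n) (λ k → U k * pow₁ g k n)

  eval₂ : PS2 → PS → PS → PS
  eval₂ F g h n =
    ∑< (suc n) (λ i → ∑< (suc n) (λ j → F i j * (pow₁ g i ·₁ pow₁ h j) n))

  comp₁₂ : PS → PS2 → PS2
  comp₁₂ U A m n = ∑< (suc (m +ℕ n)) (λ k → U k * pow₂ A k m n)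

  subst₂ : PS2 → PS2 → PS2 → PS2
  subst₂ F A B m n =
    ∑< (suc (m +ℕ n)) (λ i → ∑< (suc (m +ℕ n)) (λ j →
      F i j * (pow₂ A i ·₂ pow₂ B j) m n))

  IsFGLHom : PS → PS2 → PS2 → Set ℓ
  IsFGLHom U F F' = comp₁₂ U F ≈₂ subst₂ F' (inX U) (inY U)

module _ {c ℓ} (R : CommutativeRing c ℓ) where
  open PowerSeries R
  open CommutativeRing R using (_≈_; 0#)

  record Realization {g ℓg} (G : AbelianGroup g ℓg) (T : PS → AbelianGroup.Carrier G)
                     (F : PS2) : Set (c ⊔ ℓ ⊔ g ⊔ ℓg) where
    open AbelianGroup G renaming (_≈_ to _≈G_)
    field
      T-cong   : ∀ f h → ZeroConst f → ZeroConst h → f ≈₁ h → T f ≈G T h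
      T-inj    : ∀ f h → ZeroConst f → ZeroConst h → T f ≈G T h → f ≈₁ h
      T-zero   : T zero₁ ≈G ε
      F-zero   : ZeroConst2 F
      T-add    : ∀ f h → ZeroConst f → ZeroConst h → (T f ∙ T h) ≈G T (eval₂ F f h)

-- The hypotheses only speak about one-variable series: T₂ is injective and ψ
-- is a homomorphism, so U(F₁(g,h)) = F₂(U(g),U(h)) for all g, h ∈ τR[[τ]].
-- To reach the two-variable identity, substitute g = τ and h = τᴺ. The
-- Kronecker substitution P(X,Y) ↦ P(τ,τᴺ) is a ring homomorphism
-- R[[X,Y]] → R[[τ]] commuting with composition, so it maps both sides of
-- U(F₁(X,Y)) = F₂(U(X),U(Y)) to the two sides of the one-variable identity.
-- For x < N the coefficient of τ^(x + N j) in P(τ,τᴺ) is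
-- Σ_{i ≤ j} P(x + N(j − i), i); taking N = x + 1 and inducting on j then
-- recovers every coefficient of P from its Kronecker substitutions.
module Submission where

open import Defs
open import Algebra.Bundles using (CommutativeRing; AbelianGroup)
open import Algebra.Morphism.Structures using (module GroupMorphisms)
open import Data.Nat using (ℕ; zero; suc; _∸_; _≤_; _<_; z≤n; s≤s; _≟_; _<?_; _≤?_)
  renaming (_+_ to _+ℕ_; _*_ to _*ℕ_)
import Data.Nat.Properties as ℕP
open import Data.Nat.Induction using (<-rec)
open import Data.Nat.Solver using (module +-*-Solver)
open import Data.Sum using (inj₁; inj₂)
open import Data.Empty using (⊥-elim)
open import Relation.Nullary using (yes; no)
open import Relation.Binary.PropositionalEquality as ≡ using (_≡_; _≢_)

module FiniteSums {c ℓ} (R : CommutativeRing c ℓ) where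
  open CommutativeRing R
  open PowerSeries R using (∑<)
  open import Algebra.Properties.CommutativeSemigroup +-commutativeSemigroup
    using (interchange)

  ∑-cong : ∀ n {f g : ℕ → Carrier} → (∀ k → k < n → f k ≈ g k) → ∑< n f ≈ ∑< n g
  ∑-cong zero    f≈g = refl
  ∑-cong (suc n) f≈g =
    +-cong (∑-cong n (λ k k<n → f≈g k (ℕP.m<n⇒m<1+n k<n))) (f≈g n ℕP.≤-refl)

  ∑-zero : ∀ n {f : ℕ → Carrier} → (∀ k → k < n → f k ≈ 0#) → ∑< n f ≈ 0#
  ∑-zero zero    f≈0 = refl
  ∑-zero (suc n) f≈0 = trans
    (+-cong (∑-zero n (λ k k<n → f≈0 k (ℕP.m<n⇒m<1+n k<n))) (f≈0 n ℕP.≤-refl))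
    (+-identityˡ 0#)

  ∑-truncate : ∀ n m {f : ℕ → Carrier} → n ≤ m → (∀ k → n ≤ k → f k ≈ 0#) →
               ∑< m f ≈ ∑< n f
  ∑-truncate n zero    z≤n    _      = refl
  ∑-truncate n (suc m) n≤1+m  tail≈0 with ℕP.m≤n⇒m<n∨m≡n n≤1+m
  ... | inj₂ ≡.refl    = refl
  ... | inj₁ (s≤s n≤m) =
    trans (+-cong (∑-truncate n m n≤m tail≈0) (tail≈0 m n≤m)) (+-identityʳ _)

  ∑-distrib-+ : ∀ n (f g : ℕ → Carrier) → ∑< n (λ k → f k + g k) ≈ ∑< n f + ∑< n g
  ∑-distrib-+ zero    f g = sym (+-identityˡ 0#)
  ∑-distrib-+ (suc n) f g = trans (+-congʳ (∑-distrib-+ n f g)) (interchange _ _ _ _)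

  *-distribˡ-∑ : ∀ n x (f : ℕ → Carrier) → x * ∑< n f ≈ ∑< n (λ k → x * f k)
  *-distribˡ-∑ zero    x f = zeroʳ x
  *-distribˡ-∑ (suc n) x f = trans (distribˡ x _ _) (+-congʳ (*-distribˡ-∑ n x f))

  *-distribʳ-∑ : ∀ n x (f : ℕ → Carrier) → ∑< n f * x ≈ ∑< n (λ k → f k * x)
  *-distribʳ-∑ zero    x f = zeroˡ x
  *-distribʳ-∑ (suc n) x f = trans (distribʳ x _ _) (+-congʳ (*-distribʳ-∑ n x f))

  ∑-comm : ∀ n m (f : ℕ → ℕ → Carrier) →
           ∑< n (λ i → ∑< m (f i)) ≈ ∑< m (λ j → ∑< n (λ i → f i j))
  ∑-comm zero    m f = sym (∑-zero m (λ _ _ → refl))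
  ∑-comm (suc n) m f = trans (+-congʳ (∑-comm n m f))
    (sym (∑-distrib-+ m (λ j → ∑< n (λ i → f i j)) (f n)))

  ∑-comm₃ : ∀ n m l (f : ℕ → ℕ → ℕ → Carrier) →
            ∑< n (λ i → ∑< m (λ j → ∑< l (f i j))) ≈
            ∑< l (λ k → ∑< n (λ i → ∑< m (λ j → f i j k)))
  ∑-comm₃ n m l f = trans (∑-cong n (λ i _ → ∑-comm m l (f i))) (∑-comm n l _)

  ∑-comm₄ : ∀ n m l o (f : ℕ → ℕ → ℕ → ℕ → Carrier) →
            ∑< n (λ i → ∑< m (λ j → ∑< l (λ k → ∑< o (f i j k)))) ≈
            ∑< l (λ k → ∑< o (λ p → ∑< n (λ i → ∑< m (λ j → f i j k p))))
  ∑-comm₄ n m l o f = trans (∑-comm₃ n m l _) (∑-cong l (λ k _ → ∑-comm₃ n m o _))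

  δ : ℕ → ℕ → Carrier
  δ a b with a ≟ b
  ... | yes _ = 1#
  ... | no  _ = 0#

  δ-≡ : ∀ {a b} → a ≡ b → δ a b ≈ 1#
  δ-≡ {a} {b} a≡b with a ≟ b
  ... | yes _   = refl
  ... | no  a≢b = ⊥-elim (a≢b a≡b)

  δ-≢ : ∀ {a b} → a ≢ b → δ a b ≈ 0#
  δ-≢ {a} {b} a≢b with a ≟ b
  ... | yes a≡b = ⊥-elim (a≢b a≡b)
  ... | no  _   = refl

  δ-> : ∀ {a b} → b < a → δ a b ≈ 0#
  δ-> b<a = δ-≢ (λ a≡b → ℕP.<⇒≢ b<a (≡.sym a≡b))

  δ-cong : ∀ {a b c d} → a ≡ c → b ≡ d → δ a b ≈ δ c d
  δ-cong ≡.refl ≡.refl = refl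

  δ-cong-⇔ : ∀ {a b c d} → (a ≡ b → c ≡ d) → (c ≡ d → a ≡ b) → δ a b ≈ δ c d
  δ-cong-⇔ {a} {b} to from with a ≟ b
  ... | yes a≡b = sym (δ-≡ (to a≡b))
  ... | no  a≢b = sym (δ-≢ (λ c≡d → a≢b (from c≡d)))

  ∑-δ-outside : ∀ M x (f : ℕ → Carrier) → M ≤ x → ∑< M (λ i → δ x i * f i) ≈ 0#
  ∑-δ-outside M x f M≤x =
    ∑-zero M (λ k k<M → trans (*-congʳ (δ-> (ℕP.<-≤-trans k<M M≤x))) (zeroˡ _))

  ∑-δ-inside : ∀ M x (f : ℕ → Carrier) → x < M → ∑< M (λ i → δ x i * f i) ≈ f x
  ∑-δ-inside (suc M) x f x<1+M with ℕP.m≤n⇒m<n∨m≡n (ℕP.≤-pred x<1+M)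
  ... | inj₂ ≡.refl = trans
    (+-cong (∑-δ-outside M x f ℕP.≤-refl)
            (trans (*-congʳ (δ-≡ {x} ≡.refl)) (*-identityˡ _)))
    (+-identityˡ _)
  ... | inj₁ x<M = trans
    (+-cong (∑-δ-inside M x f x<M) (trans (*-congʳ (δ-≢ (ℕP.<⇒≢ x<M))) (zeroˡ _)))
    (+-identityʳ _)

  ∑-δ : ∀ M x (f : ℕ → Carrier) → (M ≤ x → f x ≈ 0#) → ∑< M (λ i → δ x i * f i) ≈ f x
  ∑-δ M x f beyond≈0 with x <? M
  ... | yes x<M = ∑-δ-inside M x f x<M
  ... | no  x≮M = trans (∑-δ-outside M x f M≤x) (sym (beyond≈0 M≤x))
    where M≤x = ℕP.≮⇒≥ x≮M

  ∑-δ-reindex : ∀ M (e : ℕ → ℕ → ℕ) (Z : ℕ → ℕ → Carrier) (Ψ : ℕ → Carrier) →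
    (∀ x → M ≤ x → Ψ x ≈ 0#) →
    ∑< M (λ i → ∑< M (λ a → ∑< M (λ b → δ (e a b) i * Z a b)) * Ψ i) ≈
    ∑< M (λ a → ∑< M (λ b → Z a b * Ψ (e a b)))
  ∑-δ-reindex M e Z Ψ tail≈0 = begin
      ∑< M (λ i → ∑< M (λ a → ∑< M (λ b → δ (e a b) i * Z a b)) * Ψ i)
    ≈⟨ ∑-cong M (λ i _ → trans (*-distribʳ-∑ M (Ψ i) _)
                                (∑-cong M (λ a _ → *-distribʳ-∑ M (Ψ i) _))) ⟩
      ∑< M (λ i → ∑< M (λ a → ∑< M (λ b → (δ (e a b) i * Z a b) * Ψ i)))
    ≈⟨ ∑-comm₃ M M M _ ⟩
      ∑< M (λ b → ∑< M (λ i → ∑< M (λ a → (δ (e a b) i * Z a b) * Ψ i)))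
    ≈⟨ ∑-cong M (λ b _ → ∑-comm M M _) ⟩
      ∑< M (λ b → ∑< M (λ a → ∑< M (λ i → (δ (e a b) i * Z a b) * Ψ i)))
    ≈⟨ ∑-comm M M _ ⟩
      ∑< M (λ a → ∑< M (λ b → ∑< M (λ i → (δ (e a b) i * Z a b) * Ψ i)))
    ≈⟨ ∑-cong M (λ a _ → ∑-cong M (λ b _ →
         trans (∑-cong M (λ i _ → *-assoc _ _ _))
               (∑-δ M (e a b) (λ i → Z a b * Ψ i)
                    (λ M≤e → trans (*-congˡ (tail≈0 _ M≤e)) (zeroʳ _))))) ⟩
      ∑< M (λ a → ∑< M (λ b → Z a b * Ψ (e a b)))
    ∎
    where open import Relation.Binary.Reasoning.Setoid setoid

  ∑-antidiagonal : ∀ n M (F : ℕ → ℕ → Carrier) → n < M →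
    ∑< (suc n) (λ a → F a (n ∸ a)) ≈ ∑< M (λ a → ∑< M (λ b → δ (a +ℕ b) n * F a b))
  ∑-antidiagonal n M F n<M = sym (begin
      ∑< M (λ a → ∑< M (λ b → δ (a +ℕ b) n * F a b))
    ≈⟨ ∑-truncate (suc n) M n<M (λ a n<a → ∑-zero M (λ b _ →
         trans (*-congʳ (δ-> (ℕP.<-≤-trans n<a (ℕP.m≤m+n a b)))) (zeroˡ _))) ⟩
      ∑< (suc n) (λ a → ∑< M (λ b → δ (a +ℕ b) n * F a b))
    ≈⟨ ∑-cong (suc n) (λ a a<1+n → trans
         (∑-cong M (λ b _ → *-congʳ (δ-cong-⇔
           (λ a+b≡n → ≡.trans (≡.cong (_∸ a) (≡.sym a+b≡n)) (ℕP.m+n∸m≡n a b))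
           (λ n∸a≡b → ≡.trans (≡.cong (a +ℕ_) (≡.sym n∸a≡b))
                              (ℕP.m+[n∸m]≡n (ℕP.≤-pred a<1+n))))))
         (∑-δ-inside M (n ∸ a) (F a) (ℕP.≤-<-trans (ℕP.m∸n≤m n a) n<M))) ⟩
      ∑< (suc n) (λ a → F a (n ∸ a))
    ∎)
    where open import Relation.Binary.Reasoning.Setoid setoid

module SeriesLemmas {c ℓ} (R : CommutativeRing c ℓ) where
  open CommutativeRing R
  open PowerSeries R
  open FiniteSums R

  ·₁-cong : ∀ {f f' g g'} → f ≈₁ f' → g ≈₁ g' → (f ·₁ g) ≈₁ (f' ·₁ g')
  ·₁-cong f≈f' g≈g' n = ∑-cong (suc n) (λ k _ → *-cong (f≈f' k) (g≈g' (n ∸ k)))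

  pow₁-cong : ∀ {f f'} → f ≈₁ f' → ∀ k → pow₁ f k ≈₁ pow₁ f' k
  pow₁-cong f≈f' zero    n = refl
  pow₁-cong f≈f' (suc k)   = ·₁-cong f≈f' (pow₁-cong f≈f' k)

  comp₁-cong : ∀ U {f f'} → f ≈₁ f' → comp₁ U f ≈₁ comp₁ U f'
  comp₁-cong U f≈f' n = ∑-cong (suc n) (λ k _ → *-congˡ (pow₁-cong f≈f' k n))

  eval₂-cong : ∀ F {g g' h h'} → g ≈₁ g' → h ≈₁ h' → eval₂ F g h ≈₁ eval₂ F g' h'
  eval₂-cong F g≈g' h≈h' n = ∑-cong (suc n) (λ i _ → ∑-cong (suc n) (λ j _ →
    *-congˡ (·₁-cong (pow₁-cong g≈g' i) (pow₁-cong h≈h' j) n)))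

  comp₁-ZeroConst : ∀ U f → ZeroConst U → ZeroConst (comp₁ U f)
  comp₁-ZeroConst U f U₀≈0 = trans (+-identityˡ _) (trans (*-congʳ U₀≈0) (zeroˡ _))

  eval₂-ZeroConst : ∀ F g h → ZeroConst2 F → ZeroConst (eval₂ F g h)
  eval₂-ZeroConst F g h F₀₀≈0 =
    trans (+-identityˡ _) (trans (+-identityˡ _) (trans (*-congʳ F₀₀≈0) (zeroˡ _)))

  τ^ : ℕ → PS
  τ^ a = δ a

  τ^suc-ZeroConst : ∀ k → ZeroConst (τ^ (suc k))
  τ^suc-ZeroConst k = refl

  τ^-+ : ∀ a b → (τ^ a ·₁ τ^ b) ≈₁ τ^ (a +ℕ b)
  τ^-+ a b n with a ≤? n
  ... | yes a≤n = trans (∑-δ-inside (suc n) a (λ k → δ b (n ∸ k)) (s≤s a≤n))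
    (δ-cong-⇔ (λ b≡n∸a → ≡.trans (≡.cong (a +ℕ_) b≡n∸a) (ℕP.m+[n∸m]≡n a≤n))
              (λ a+b≡n → ≡.trans (≡.sym (ℕP.m+n∸m≡n a b)) (≡.cong (_∸ a) a+b≡n)))
  ... | no  a≰n = trans (∑-δ-outside (suc n) a (λ k → δ b (n ∸ k)) n<a)
    (sym (δ-> (ℕP.<-≤-trans n<a (ℕP.m≤m+n a b))))
    where n<a = ℕP.≰⇒> a≰n

  one₁≈τ^0 : one₁ ≈₁ τ^ 0
  one₁≈τ^0 zero    = refl
  one₁≈τ^0 (suc n) = refl

  pow₁-τ^ : ∀ a k → pow₁ (τ^ a) k ≈₁ τ^ (a *ℕ k)
  pow₁-τ^ a zero    n = trans (one₁≈τ^0 n) (δ-cong (≡.sym (ℕP.*-zeroʳ a)) ≡.refl)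
  pow₁-τ^ a (suc k) n = trans (·₁-cong (λ _ → refl) (pow₁-τ^ a k) n)
    (trans (τ^-+ a (a *ℕ k) n) (δ-cong (≡.sym (ℕP.*-suc a k)) ≡.refl))

  ·₂-as-∑-δ : ∀ M (A B : PS2) i j → i < M → j < M →
    (A ·₂ B) i j ≈ ∑< M (λ a → ∑< M (λ c → δ (a +ℕ c) i *
                     ∑< M (λ b → ∑< M (λ d → δ (b +ℕ d) j * (A a b * B c d)))))
  ·₂-as-∑-δ M A B i j i<M j<M = trans
    (∑-antidiagonal i M (λ a c → ∑< (suc j) (λ b → A a b * B c (j ∸ b))) i<M)
    (∑-cong M (λ a _ → ∑-cong M (λ c _ →
      *-congˡ (∑-antidiagonal j M (λ b d → A a b * B c d) j<M))))

  HasOrder : PS2 → ℕ → Set ℓ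
  HasOrder C k = ∀ p q → p +ℕ q < k → C p q ≈ 0#

  ZeroConst2⇒HasOrder1 : ∀ {A} → ZeroConst2 A → HasOrder A 1
  ZeroConst2⇒HasOrder1 A₀₀≈0 zero    zero    _         = A₀₀≈0
  ZeroConst2⇒HasOrder1 A₀₀≈0 zero    (suc q) (s≤s ())
  ZeroConst2⇒HasOrder1 A₀₀≈0 (suc p) q       (s≤s ())

  HasOrder-·₂ : ∀ {C D k l} → HasOrder C k → HasOrder D l → HasOrder (C ·₂ D) (k +ℕ l)
  HasOrder-·₂ {C} {D} {k} {l} ordC ordD p q p+q<k+l =
    ∑-zero (suc p) (λ a a<1+p → ∑-zero (suc q) (λ b b<1+q →
      term≈0 a b (ℕP.≤-pred a<1+p) (ℕP.≤-pred b<1+q)))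
    where
    open +-*-Solver
    degrees-add : ∀ a b → a ≤ p → b ≤ q → (a +ℕ b) +ℕ ((p ∸ a) +ℕ (q ∸ b)) ≡ p +ℕ q
    degrees-add a b a≤p b≤q = ≡.trans
      (solve 4 (λ a b x y → (a :+ b) :+ (x :+ y) := (a :+ x) :+ (b :+ y)) ≡.refl
             a b (p ∸ a) (q ∸ b))
      (≡.cong₂ _+ℕ_ (ℕP.m+[n∸m]≡n a≤p) (ℕP.m+[n∸m]≡n b≤q))
    term≈0 : ∀ a b → a ≤ p → b ≤ q → C a b * D (p ∸ a) (q ∸ b) ≈ 0#
    term≈0 a b a≤p b≤q with a +ℕ b <? k | (p ∸ a) +ℕ (q ∸ b) <? l
    ... | yes a+b<k | _       = trans (*-congʳ (ordC a b a+b<k)) (zeroˡ _)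
    ... | no  _     | yes r<l = trans (*-congˡ (ordD _ _ r<l)) (zeroʳ _)
    ... | no  a+b≮k | no  r≮l = ⊥-elim (ℕP.<⇒≱ p+q<k+l
      (≡.subst (k +ℕ l ≤_) (degrees-add a b a≤p b≤q)
               (ℕP.+-mono-≤ (ℕP.≮⇒≥ a+b≮k) (ℕP.≮⇒≥ r≮l))))

  HasOrder-pow₂ : ∀ {A} → HasOrder A 1 → ∀ k → HasOrder (pow₂ A k) k
  HasOrder-pow₂ ordA zero    p q ()
  HasOrder-pow₂ ordA (suc k)   = HasOrder-·₂ ordA (HasOrder-pow₂ ordA k)

-- kron P = P(τ, τᴺ), coefficientwise: kron P n = Σ {P i j | i + N j = n}.
module Kronecker {c ℓ} (R : CommutativeRing c ℓ) (N' : ℕ) where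
  open CommutativeRing R
  open PowerSeries R
  open FiniteSums R
  open SeriesLemmas R
  open import Relation.Binary.Reasoning.Setoid setoid

  N : ℕ
  N = suc N'

  j≤Nj : ∀ j → j ≤ N *ℕ j
  j≤Nj j = ℕP.m≤n*m j N

  Φ : ℕ → ℕ → ℕ → Carrier
  Φ n i j = δ (i +ℕ N *ℕ j) n

  kron≤ : ℕ → PS2 → PS
  kron≤ M P n = ∑< M (λ i → ∑< M (λ j → P i j * Φ n i j))

  kron : PS2 → PS
  kron P n = kron≤ (suc n) P n

  Φ-beyond-i : ∀ {n} i j → n < i → Φ n i j ≈ 0#
  Φ-beyond-i i j n<i = δ-> (ℕP.<-≤-trans n<i (ℕP.m≤m+n i _))

  Φ-beyond-j : ∀ {n} i j → n < j → Φ n i j ≈ 0#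
  Φ-beyond-j i j n<j =
    δ-> (ℕP.<-≤-trans n<j (ℕP.≤-trans (j≤Nj j) (ℕP.m≤n+m _ i)))

  kron≤≈kron : ∀ M P n → n < M → kron≤ M P n ≈ kron P n
  kron≤≈kron M P n n<M = trans
    (∑-truncate (suc n) M n<M (λ i n<i →
      ∑-zero M (λ j _ → trans (*-congˡ (Φ-beyond-i i j n<i)) (zeroʳ _))))
    (∑-cong (suc n) (λ i _ → ∑-truncate (suc n) M n<M (λ j n<j →
      trans (*-congˡ (Φ-beyond-j i j n<j)) (zeroʳ _))))

  kron⊗ : PS2 → PS2 → PS
  kron⊗ A B n = ∑< M (λ a → ∑< M (λ b → ∑< M (λ c → ∑< M (λ d →
                  A a b * (B c d * δ ((a +ℕ N *ℕ b) +ℕ (c +ℕ N *ℕ d)) n)))))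
    where M = suc n

  kron-·₂-expand : ∀ A B n → kron (A ·₂ B) n ≈ kron⊗ A B n
  kron-·₂-expand A B n = begin
      ∑< M (λ i → ∑< M (λ j → (A ·₂ B) i j * Φ n i j))
    ≈⟨ ∑-cong M (λ i i<M → ∑-cong M (λ j j<M →
         *-congʳ (·₂-as-∑-δ M A B i j i<M j<M))) ⟩
      ∑< M (λ i → ∑< M (λ j →
        ∑< M (λ a → ∑< M (λ c → δ (a +ℕ c) i * Y a c j)) * Φ n i j))
    ≈⟨ ∑-comm M M _ ⟩
      ∑< M (λ j → ∑< M (λ i →
        ∑< M (λ a → ∑< M (λ c → δ (a +ℕ c) i * Y a c j)) * Φ n i j))
    ≈⟨ ∑-cong M (λ j _ → ∑-δ-reindex M _+ℕ_ (λ a c → Y a c j) (λ i → Φ n i j)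
         (λ i M≤i → Φ-beyond-i i j M≤i)) ⟩
      ∑< M (λ j → ∑< M (λ a → ∑< M (λ c → Y a c j * Φ n (a +ℕ c) j)))
    ≈⟨ ∑-comm₃ M M M _ ⟩
      ∑< M (λ c → ∑< M (λ j → ∑< M (λ a → Y a c j * Φ n (a +ℕ c) j)))
    ≈⟨ trans (∑-cong M (λ c _ → ∑-comm M M _)) (∑-comm M M _) ⟩
      ∑< M (λ a → ∑< M (λ c → ∑< M (λ j → Y a c j * Φ n (a +ℕ c) j)))
    ≈⟨ ∑-cong M (λ a _ → ∑-cong M (λ c _ →
         ∑-δ-reindex M _+ℕ_ (λ b d → A a b * B c d) (Φ n (a +ℕ c))
           (λ j M≤j → Φ-beyond-j (a +ℕ c) j M≤j))) ⟩
      ∑< M (λ a → ∑< M (λ c → ∑< M (λ b → ∑< M (λ d →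
        (A a b * B c d) * Φ n (a +ℕ c) (b +ℕ d)))))
    ≈⟨ ∑-cong M (λ a _ → ∑-comm M M _) ⟩
      ∑< M (λ a → ∑< M (λ b → ∑< M (λ c → ∑< M (λ d →
        (A a b * B c d) * Φ n (a +ℕ c) (b +ℕ d)))))
    ≈⟨ ∑-cong M (λ a _ → ∑-cong M (λ b _ → ∑-cong M (λ c _ → ∑-cong M (λ d _ →
         trans (*-assoc _ _ _) (*-congˡ (*-congˡ (δ-cong (exponents a b c d) ≡.refl))))))) ⟩
      kron⊗ A B n
    ∎
    where
    M = suc n
    Y : ℕ → ℕ → ℕ → Carrier
    Y a c j = ∑< M (λ b → ∑< M (λ d → δ (b +ℕ d) j * (A a b * B c d)))
    open +-*-Solver
    exponents : ∀ a b c d → (a +ℕ c) +ℕ N *ℕ (b +ℕ d) ≡ (a +ℕ N *ℕ b) +ℕ (c +ℕ N *ℕ d)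
    exponents a b c d = solve 5
      (λ a b c d N → (a :+ c) :+ N :* (b :+ d) := (a :+ N :* b) :+ (c :+ N :* d))
      ≡.refl a b c d N

  kron-·₁-expand : ∀ A B n → (kron A ·₁ kron B) n ≈ kron⊗ A B n
  kron-·₁-expand A B n = begin
      ∑< (suc n) (λ k → kron A k * kron B (n ∸ k))
    ≈⟨ ∑-antidiagonal n M (λ k k' → kron A k * kron B k') ℕP.≤-refl ⟩
      ∑< M (λ k → ∑< M (λ k' → δ (k +ℕ k') n * (kron A k * kron B k')))
    ≈⟨ ∑-cong M (λ k k<M → ∑-cong M (λ k' k'<M →
         trans (*-congˡ (*-cong (sym (kron≤≈kron M A k k<M)) (sym (kron≤≈kron M B k' k'<M))))
               (trans (*-comm _ _) (*-assoc _ _ _)))) ⟩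
      ∑< M (λ k → ∑< M (λ k' → kron≤ M A k * (kron≤ M B k' * δ (k +ℕ k') n)))
    ≈⟨ ∑-cong M (λ k _ → sym (*-distribˡ-∑ M _ _)) ⟩
      ∑< M (λ k → kron≤ M A k * Ψ k)
    ≈⟨ ∑-cong M (λ k _ → *-congʳ (kron≤-as-∑-δ A k)) ⟩
      ∑< M (λ k → ∑< M (λ a → ∑< M (λ b → δ (a +ℕ N *ℕ b) k * A a b)) * Ψ k)
    ≈⟨ ∑-δ-reindex M (λ a b → a +ℕ N *ℕ b) A Ψ (λ x M≤x → ∑-zero M (λ k' _ →
         trans (*-congˡ (δ-> (ℕP.<-≤-trans M≤x (ℕP.m≤m+n x k')))) (zeroʳ _))) ⟩
      ∑< M (λ a → ∑< M (λ b → A a b * Ψ (a +ℕ N *ℕ b)))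
    ≈⟨ ∑-cong M (λ a _ → ∑-cong M (λ b _ → *-congˡ (trans
         (∑-cong M (λ k' _ → *-congʳ (kron≤-as-∑-δ B k')))
         (∑-δ-reindex M (λ c d → c +ℕ N *ℕ d) B (λ k' → δ ((a +ℕ N *ℕ b) +ℕ k') n)
           (λ y M≤y → δ-> (ℕP.<-≤-trans M≤y (ℕP.m≤n+m y (a +ℕ N *ℕ b)))))))) ⟩
      ∑< M (λ a → ∑< M (λ b → A a b * ∑< M (λ c → ∑< M (λ d →
        B c d * δ ((a +ℕ N *ℕ b) +ℕ (c +ℕ N *ℕ d)) n))))
    ≈⟨ ∑-cong M (λ a _ → ∑-cong M (λ b _ →
         trans (*-distribˡ-∑ M _ _) (∑-cong M (λ c _ → *-distribˡ-∑ M _ _)))) ⟩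
      kron⊗ A B n
    ∎
    where
    M = suc n
    Ψ : ℕ → Carrier
    Ψ k = ∑< M (λ k' → kron≤ M B k' * δ (k +ℕ k') n)
    kron≤-as-∑-δ : ∀ P k →
      kron≤ M P k ≈ ∑< M (λ a → ∑< M (λ b → δ (a +ℕ N *ℕ b) k * P a b))
    kron≤-as-∑-δ P k = ∑-cong M (λ a _ → ∑-cong M (λ b _ → *-comm _ _))

  kron-·₂ : ∀ A B → kron (A ·₂ B) ≈₁ (kron A ·₁ kron B)
  kron-·₂ A B n = trans (kron-·₂-expand A B n) (sym (kron-·₁-expand A B n))

  kron-one₂ : kron one₂ ≈₁ one₁
  kron-one₂ n = begin
      ∑< M (λ i → ∑< M (λ j → one₂ i j * Φ n i j))
    ≈⟨ ∑-cong M (λ i _ → ∑-cong M (λ j _ →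
         trans (*-congʳ (one₂≈δδ i j)) (*-assoc _ _ _))) ⟩
      ∑< M (λ i → ∑< M (λ j → δ 0 i * (δ 0 j * Φ n i j)))
    ≈⟨ ∑-cong M (λ i _ → trans (sym (*-distribˡ-∑ M _ _))
                                (*-congˡ (∑-δ-inside M 0 (Φ n i) (s≤s z≤n)))) ⟩
      ∑< M (λ i → δ 0 i * Φ n i 0)
    ≈⟨ ∑-δ-inside M 0 (λ i → Φ n i 0) (s≤s z≤n) ⟩
      δ (N *ℕ 0) n
    ≈⟨ trans (δ-cong (ℕP.*-zeroʳ N) ≡.refl) (sym (one₁≈τ^0 n)) ⟩
      one₁ n
    ∎
    where
    M = suc n
    one₂≈δδ : ∀ i j → one₂ i j ≈ δ 0 i * δ 0 j
    one₂≈δδ zero    zero    = sym (*-identityˡ _)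
    one₂≈δδ zero    (suc j) = sym (zeroʳ _)
    one₂≈δδ (suc i) j       = sym (zeroˡ _)

  kron-pow₂ : ∀ A k → kron (pow₂ A k) ≈₁ pow₁ (kron A) k
  kron-pow₂ A zero      = kron-one₂
  kron-pow₂ A (suc k) n =
    trans (kron-·₂ A (pow₂ A k) n) (·₁-cong (λ _ → refl) (kron-pow₂ A k) n)

  kron-HasOrder : ∀ {C k} → HasOrder C k → ∀ n → n < k → kron C n ≈ 0#
  kron-HasOrder {C} {k} ordC n n<k =
    ∑-zero (suc n) (λ i _ → ∑-zero (suc n) (λ j _ → term≈0 i j))
    where
    term≈0 : ∀ i j → C i j * Φ n i j ≈ 0#
    term≈0 i j with i +ℕ j <? k
    ... | yes i+j<k = trans (*-congʳ (ordC i j i+j<k)) (zeroˡ _)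
    ... | no  i+j≮k = trans (*-congˡ (δ-> (ℕP.<-≤-trans n<k
          (ℕP.≤-trans (ℕP.≮⇒≥ i+j≮k) (ℕP.+-monoʳ-≤ i (j≤Nj j)))))) (zeroʳ _)

  eval₂-τ,τᴺ≈kron : ∀ P → eval₂ P (τ^ 1) (τ^ N) ≈₁ kron P
  eval₂-τ,τᴺ≈kron P n = ∑-cong (suc n) (λ i _ → ∑-cong (suc n) (λ j _ → *-congˡ
    (trans (·₁-cong (pow₁-τ^ 1 i) (pow₁-τ^ N j) n)
      (trans (τ^-+ (1 *ℕ i) (N *ℕ j) n)
             (δ-cong (≡.cong (_+ℕ N *ℕ j) (ℕP.*-identityˡ i)) ≡.refl)))))

  kron-comp₁₂ : ∀ U F → HasOrder F 1 → kron (comp₁₂ U F) ≈₁ comp₁ U (kron F)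
  kron-comp₁₂ U F ordF n = begin
      ∑< M (λ i → ∑< M (λ j → ∑< (suc (i +ℕ j)) (λ k → U k * pow₂ F k i j) * Φ n i j))
    ≈⟨ ∑-cong M (λ i i<M → ∑-cong M (λ j j<M → *-congʳ (sym
         (∑-truncate (suc (i +ℕ j)) L (ℕP.+-mono-< i<M j<M) (λ k i+j<k →
           trans (*-congˡ (HasOrder-pow₂ ordF k i j i+j<k)) (zeroʳ _)))))) ⟩
      ∑< M (λ i → ∑< M (λ j → ∑< L (λ k → U k * pow₂ F k i j) * Φ n i j))
    ≈⟨ ∑-cong M (λ i _ → ∑-cong M (λ j _ →
         trans (*-distribʳ-∑ L _ _) (∑-cong L (λ k _ → *-assoc _ _ _)))) ⟩
      ∑< M (λ i → ∑< M (λ j → ∑< L (λ k → U k * (pow₂ F k i j * Φ n i j))))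
    ≈⟨ ∑-comm₃ M M L _ ⟩
      ∑< L (λ k → ∑< M (λ i → ∑< M (λ j → U k * (pow₂ F k i j * Φ n i j))))
    ≈⟨ ∑-cong L (λ k _ → sym
         (trans (*-distribˡ-∑ M _ _) (∑-cong M (λ i _ → *-distribˡ-∑ M _ _)))) ⟩
      ∑< L (λ k → U k * kron (pow₂ F k) n)
    ≈⟨ ∑-truncate M L (ℕP.m≤m+n M M) (λ k n<k →
         trans (*-congˡ (kron-HasOrder (HasOrder-pow₂ ordF k) n n<k)) (zeroʳ _)) ⟩
      ∑< M (λ k → U k * kron (pow₂ F k) n)
    ≈⟨ ∑-cong M (λ k _ → *-congˡ (kron-pow₂ F k n)) ⟩
      comp₁ U (kron F) n
    ∎
    where
    M = suc n
    L = M +ℕ M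

  kron-subst₂ : ∀ F A B → HasOrder A 1 → HasOrder B 1 →
                kron (subst₂ F A B) ≈₁ eval₂ F (kron A) (kron B)
  kron-subst₂ F A B ordA ordB n = begin
      ∑< M (λ p → ∑< M (λ q → ∑< (suc (p +ℕ q)) (λ i → ∑< (suc (p +ℕ q)) (λ j →
        F i j * G i j p q)) * Φ n p q))
    ≈⟨ ∑-cong M (λ p p<M → ∑-cong M (λ q q<M →
         *-congʳ (sym (widen p q (ℕP.+-mono-< p<M q<M))))) ⟩
      ∑< M (λ p → ∑< M (λ q → ∑< L (λ i → ∑< L (λ j → F i j * G i j p q)) * Φ n p q))
    ≈⟨ ∑-cong M (λ p _ → ∑-cong M (λ q _ →
         trans (*-distribʳ-∑ L _ _) (∑-cong L (λ i _ →
           trans (*-distribʳ-∑ L _ _) (∑-cong L (λ j _ → *-assoc _ _ _)))))) ⟩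
      ∑< M (λ p → ∑< M (λ q → ∑< L (λ i → ∑< L (λ j →
        F i j * (G i j p q * Φ n p q)))))
    ≈⟨ ∑-comm₄ M M L L _ ⟩
      ∑< L (λ i → ∑< L (λ j → ∑< M (λ p → ∑< M (λ q →
        F i j * (G i j p q * Φ n p q)))))
    ≈⟨ ∑-cong L (λ i _ → ∑-cong L (λ j _ →
         sym (trans (*-distribˡ-∑ M _ _) (∑-cong M (λ p _ → *-distribˡ-∑ M _ _))))) ⟩
      ∑< L (λ i → ∑< L (λ j → F i j * kron (G i j) n))
    ≈⟨ trans (∑-cong L (λ i _ → ∑-truncate M L M≤L (λ j n<j →
                term≈0 i j (ℕP.m≤n+m j i) n<j)))
             (∑-truncate M L M≤L (λ i n<i →
                ∑-zero M (λ j _ → term≈0 i j (ℕP.m≤m+n i j) n<i))) ⟩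
      ∑< M (λ i → ∑< M (λ j → F i j * kron (G i j) n))
    ≈⟨ ∑-cong M (λ i _ → ∑-cong M (λ j _ → *-congˡ
         (trans (kron-·₂ (pow₂ A i) (pow₂ B j) n)
                (·₁-cong (kron-pow₂ A i) (kron-pow₂ B j) n)))) ⟩
      eval₂ F (kron A) (kron B) n
    ∎
    where
    M = suc n
    L = M +ℕ M
    M≤L : M ≤ L
    M≤L = ℕP.m≤m+n M M
    G : ℕ → ℕ → PS2
    G i j = pow₂ A i ·₂ pow₂ B j
    ordG : ∀ i j → HasOrder (G i j) (i +ℕ j)
    ordG i j = HasOrder-·₂ (HasOrder-pow₂ ordA i) (HasOrder-pow₂ ordB j)
    term≈0 : ∀ i j {d} → d ≤ i +ℕ j → n < d → F i j * kron (G i j) n ≈ 0#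
    term≈0 i j d≤i+j n<d =
      trans (*-congˡ (kron-HasOrder (ordG i j) n (ℕP.<-≤-trans n<d d≤i+j))) (zeroʳ _)
    widen : ∀ p q → p +ℕ q < L →
      ∑< L (λ i → ∑< L (λ j → F i j * G i j p q)) ≈
      ∑< (suc (p +ℕ q)) (λ i → ∑< (suc (p +ℕ q)) (λ j → F i j * G i j p q))
    widen p q S≤L = trans
      (∑-truncate (suc (p +ℕ q)) L S≤L (λ i p+q<i → ∑-zero L (λ j _ →
        trans (*-congˡ (ordG i j p q (ℕP.<-≤-trans p+q<i (ℕP.m≤m+n i j)))) (zeroʳ _))))
      (∑-cong (suc (p +ℕ q)) (λ i _ → ∑-truncate (suc (p +ℕ q)) L S≤L (λ j p+q<j →
        trans (*-congˡ (ordG i j p q (ℕP.<-≤-trans p+q<j (ℕP.m≤n+m j i)))) (zeroʳ _))))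

  kron-inX : ∀ U → kron (inX U) ≈₁ comp₁ U (τ^ 1)
  kron-inX U n = begin
      ∑< M (λ i → ∑< M (λ j → inX U i j * Φ n i j))
    ≈⟨ ∑-cong M (λ i _ → trans
         (∑-cong M (λ j _ → trans (*-congʳ (inX≈δ i j)) (*-assoc _ _ _)))
                                (∑-δ-inside M 0 (λ j → U i * Φ n i j) (s≤s z≤n))) ⟩
      ∑< M (λ i → U i * Φ n i 0)
    ≈⟨ ∑-cong M (λ k _ → *-congˡ (trans
         (δ-cong (≡.trans (≡.cong (k +ℕ_) (ℕP.*-zeroʳ N)) (ℕP.+-identityʳ k)) ≡.refl)
         (trans (δ-cong (≡.sym (ℕP.*-identityˡ k)) ≡.refl) (sym (pow₁-τ^ 1 k n))))) ⟩
      comp₁ U (τ^ 1) n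
    ∎
    where
    M = suc n
    inX≈δ : ∀ i j → inX U i j ≈ δ 0 j * U i
    inX≈δ i zero    = sym (*-identityˡ _)
    inX≈δ i (suc j) = sym (zeroˡ _)

  kron-inY : ∀ U → kron (inY U) ≈₁ comp₁ U (τ^ N)
  kron-inY U n = begin
      ∑< M (λ i → ∑< M (λ j → inY U i j * Φ n i j))
    ≈⟨ ∑-cong M (λ i _ → trans
         (∑-cong M (λ j _ → trans (*-congʳ (inY≈δ i j)) (*-assoc _ _ _)))
                                (sym (*-distribˡ-∑ M _ _))) ⟩
      ∑< M (λ i → δ 0 i * ∑< M (λ j → U j * Φ n i j))
    ≈⟨ ∑-δ-inside M 0 (λ i → ∑< M (λ j → U j * Φ n i j)) (s≤s z≤n) ⟩
      ∑< M (λ j → U j * Φ n 0 j)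
    ≈⟨ ∑-cong M (λ k _ → *-congˡ (sym (pow₁-τ^ N k n))) ⟩
      comp₁ U (τ^ N) n
    ∎
    where
    M = suc n
    inY≈δ : ∀ i j → inY U i j ≈ δ 0 i * U j
    inY≈δ zero    j = sym (*-identityˡ _)
    inY≈δ (suc i) j = sym (zeroˡ _)

  kron-digits : ∀ C x q → x < N →
    kron C (x +ℕ N *ℕ q) ≈ ∑< (suc q) (λ j → C (x +ℕ N *ℕ q ∸ N *ℕ j) j)
  kron-digits C x q x<N = begin
      ∑< M (λ i → ∑< M (λ j → C i j * Φ n i j))
    ≈⟨ ∑-comm M M _ ⟩
      ∑< M (λ j → ∑< M (λ i → C i j * Φ n i j))
    ≈⟨ ∑-truncate (suc q) M (s≤s (ℕP.≤-trans (j≤Nj q) (ℕP.m≤n+m _ x))) (λ j q<j →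
         ∑-zero M (λ i _ →
           trans (*-congˡ (δ-> (ℕP.<-≤-trans (n<Nj j q<j) (ℕP.m≤n+m _ i)))) (zeroʳ _))) ⟩
      ∑< (suc q) (λ j → ∑< M (λ i → C i j * Φ n i j))
    ≈⟨ ∑-cong (suc q) (λ j j≤q → trans
         (∑-cong M (λ i _ → trans (*-comm _ _) (*-congʳ (δ-cong-⇔
           (λ i+Nj≡n → ≡.trans (≡.cong (_∸ N *ℕ j) (≡.sym i+Nj≡n))
                               (ℕP.m+n∸n≡m i (N *ℕ j)))
           (λ n∸Nj≡i → ≡.trans (≡.cong (_+ℕ N *ℕ j) (≡.sym n∸Nj≡i))
                               (ℕP.m∸n+n≡m (Nj≤n j (ℕP.≤-pred j≤q))))))))
         (∑-δ-inside M (n ∸ N *ℕ j) (λ i → C i j) (s≤s (ℕP.m∸n≤m n (N *ℕ j))))) ⟩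
      ∑< (suc q) (λ j → C (n ∸ N *ℕ j) j)
    ∎
    where
    n = x +ℕ N *ℕ q
    M = suc n
    n<Nj : ∀ j → q < j → n < N *ℕ j
    n<Nj j q<j = ℕP.<-≤-trans (ℕP.+-monoˡ-< (N *ℕ q) x<N)
      (≡.subst (_≤ N *ℕ j) (ℕP.*-suc N q) (ℕP.*-monoʳ-≤ N q<j))
    Nj≤n : ∀ j → j ≤ q → N *ℕ j ≤ n
    Nj≤n j j≤q = ℕP.≤-trans (ℕP.*-monoʳ-≤ N j≤q) (ℕP.m≤n+m _ x)

module _ {c ℓ} (R : CommutativeRing c ℓ) where
  open CommutativeRing R
  open PowerSeries R
  open FiniteSums R using (∑-cong)
  module K = Kronecker R
  open import Algebra.Properties.Ring ring using (+-cancelˡ)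
  open import Relation.Binary.Reasoning.Setoid setoid

  kron-injective : ∀ {C₁ C₂} → (∀ N' → K.kron N' C₁ ≈₁ K.kron N' C₂) → C₁ ≈₂ C₂
  kron-injective {C₁} {C₂} kron≈ x j = <-rec (λ j → ∀ x → C₁ x j ≈ C₂ x j) column j x
    where
    column : ∀ j → (∀ {i} → i < j → ∀ x → C₁ x i ≈ C₂ x i) → ∀ x → C₁ x j ≈ C₂ x j
    column j earlier x =
      ≡.subst (λ y → C₁ y j ≈ C₂ y j) (ℕP.m+n∸n≡m x (suc x *ℕ j)) last-terms
      where
      open Kronecker R x using (kron; kron-digits)
      entry : PS2 → ℕ → Carrier
      entry C i = C (x +ℕ suc x *ℕ j ∸ suc x *ℕ i) i
      last-terms : entry C₁ j ≈ entry C₂ j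
      last-terms = +-cancelˡ (∑< j (entry C₁)) _ _ (begin
          ∑< j (entry C₁) + entry C₁ j
        ≈⟨ sym (kron-digits C₁ x j ℕP.≤-refl) ⟩
          kron C₁ (x +ℕ suc x *ℕ j)
        ≈⟨ kron≈ x _ ⟩
          kron C₂ (x +ℕ suc x *ℕ j)
        ≈⟨ kron-digits C₂ x j ℕP.≤-refl ⟩
          ∑< j (entry C₂) + entry C₂ j
        ≈⟨ +-congʳ (∑-cong j (λ i i<j → sym (earlier i<j _))) ⟩
          ∑< j (entry C₁) + entry C₂ j
        ∎)

  IsFGLHom-from-series : ∀ {U F₁ F₂} → ZeroConst U → ZeroConst2 F₁ →
    (∀ g h → ZeroConst g → ZeroConst h →
       comp₁ U (eval₂ F₁ g h) ≈₁ eval₂ F₂ (comp₁ U g) (comp₁ U h)) →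
    IsFGLHom U F₁ F₂
  IsFGLHom-from-series {U} {F₁} {F₂} U₀≈0 F₁-zero U-intertwines = kron-injective kron-agree
    where
    open SeriesLemmas R
    kron-agree : ∀ N' → K.kron N' (comp₁₂ U F₁) ≈₁ K.kron N' (subst₂ F₂ (inX U) (inY U))
    kron-agree N' n = begin
        kron (comp₁₂ U F₁) n
      ≈⟨ kron-comp₁₂ U F₁ (ZeroConst2⇒HasOrder1 F₁-zero) n ⟩
        comp₁ U (kron F₁) n
      ≈˘⟨ comp₁-cong U (eval₂-τ,τᴺ≈kron F₁) n ⟩
        comp₁ U (eval₂ F₁ (τ^ 1) (τ^ N)) n
      ≈⟨ U-intertwines _ _ (τ^suc-ZeroConst 0) (τ^suc-ZeroConst N') n ⟩
        eval₂ F₂ (comp₁ U (τ^ 1)) (comp₁ U (τ^ N)) n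
      ≈˘⟨ eval₂-cong F₂ (kron-inX U) (kron-inY U) n ⟩
        eval₂ F₂ (kron (inX U)) (kron (inY U)) n
      ≈˘⟨ kron-subst₂ F₂ (inX U) (inY U) inX-order inY-order n ⟩
        kron (subst₂ F₂ (inX U) (inY U)) n
      ∎
      where
      open Kronecker R N'
      inX-order : HasOrder (inX U) 1
      inX-order = ZeroConst2⇒HasOrder1 {inX U} U₀≈0
      inY-order : HasOrder (inY U) 1
      inY-order = ZeroConst2⇒HasOrder1 {inY U} U₀≈0

lemma2p1 : ∀ {c ℓ g₁ ℓ₁ g₂ ℓ₂} (R : CommutativeRing c ℓ)
    (G₁ : AbelianGroup g₁ ℓ₁) (G₂ : AbelianGroup g₂ ℓ₂)
    (T₁ : PowerSeries.PS R → AbelianGroup.Carrier G₁)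
    (T₂ : PowerSeries.PS R → AbelianGroup.Carrier G₂)
    (F₁ F₂ : PowerSeries.PS2 R) →
    Realization R G₁ T₁ F₁ → Realization R G₂ T₂ F₂ →
    (ψ : AbelianGroup.Carrier G₁ → AbelianGroup.Carrier G₂) →
    GroupMorphisms.IsGroupHomomorphism (AbelianGroup.rawGroup G₁) (AbelianGroup.rawGroup G₂) ψ →
    (U : PowerSeries.PS R) → PowerSeries.ZeroConst R U →
    (∀ f → PowerSeries.ZeroConst R f →
    AbelianGroup._≈_ G₂ (ψ (T₁ f)) (T₂ (PowerSeries.comp₁ R U f))) →
    PowerSeries.IsFGLHom R U F₁ F₂
lemma2p1 R G₁ G₂ T₁ T₂ F₁ F₂ r₁ r₂ ψ ψ-hom U U₀≈0 ψT₁≈T₂U =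
  IsFGLHom-from-series R U₀≈0 R₁.F-zero U-intertwines
  where
  open PowerSeries R
  open SeriesLemmas R using (comp₁-ZeroConst; eval₂-ZeroConst)
  module R₁ = Realization r₁
  module R₂ = Realization r₂

  U-intertwines : ∀ g h → ZeroConst g → ZeroConst h →
                  comp₁ U (eval₂ F₁ g h) ≈₁ eval₂ F₂ (comp₁ U g) (comp₁ U h)
  U-intertwines g h g₀≈0 h₀≈0 = R₂.T-inj _ _
    (comp₁-ZeroConst U (eval₂ F₁ g h) U₀≈0)
    (eval₂-ZeroConst F₂ (comp₁ U g) (comp₁ U h) R₂.F-zero) (begin
        T₂ (comp₁ U (eval₂ F₁ g h))
      ≈˘⟨ ψT₁≈T₂U (eval₂ F₁ g h) (eval₂-ZeroConst F₁ g h R₁.F-zero) ⟩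
        ψ (T₁ (eval₂ F₁ g h))
      ≈˘⟨ ⟦⟧-cong (R₁.T-add g h g₀≈0 h₀≈0) ⟩
        ψ (T₁ g G₁.∙ T₁ h)
      ≈⟨ homo (T₁ g) (T₁ h) ⟩
        ψ (T₁ g) G₂.∙ ψ (T₁ h)
      ≈⟨ G₂.∙-cong (ψT₁≈T₂U g g₀≈0) (ψT₁≈T₂U h h₀≈0) ⟩
        T₂ (comp₁ U g) G₂.∙ T₂ (comp₁ U h)
      ≈⟨ R₂.T-add _ _ (comp₁-ZeroConst U g U₀≈0) (comp₁-ZeroConst U h U₀≈0) ⟩
        T₂ (eval₂ F₂ (comp₁ U g) (comp₁ U h))
      ∎)
    where
    module G₁ = AbelianGroup G₁
    module G₂ = AbelianGroup G₂
    open GroupMorphisms.IsGroupHomomorphism ψ-hom using (⟦⟧-cong; homo)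
    open import Relation.Binary.Reasoning.Setoid G₂.setoid
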